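{- Over intuitionistic logic, the following are equivalent: (i) for every set $S$ and every saturation $\mathcal{A}$ on $S$, $\mathbb{A}(\mathbb{J}(\mathcal{A}))=\mathcal{A}$; (ii) the law of excluded middle.
   Context: The ambient framework is intuitionistic (impredicative) set theory. An operator on $S$ is a map $\mathrm{Pow}(S)\to\mathrm{Pow}(S)$, ordered pointwise by inclusion. For $U,V\subseteq S$, $U\between V$ means there exists $a\in U\cap V$. $\mathcal{O}\triangleleft\mathcal{O}'$ means: for all $U,V\subseteq S$, $\mathcal{O}(U)\between\mathcal{O}'(V)$ implies $U\between\mathcal{O}'(V)$. A saturation is a monotone idempotent operator $\mathcal{A}$ with $U\subseteq\mathcal{A}(U)$ for all $U$; a reduction is a monotone idempotent operator $\mathcal{J}$ with $\mathcal{J}(U)\subseteq U$ for all $U$. For a reduction $\mathcal{J}$, $\mathbb{A}(\mathcal{J})$ is the greatest saturation $\mathcal{A}$ with $\mathcal{A}\triangleleft\mathcal{J}$; for a saturation $\mathcal{A}$, $\mathbb{J}(\mathcal{A})$ is the greatest reduction $\mathcal{J}$ with $\mathcal{A}\triangleleft\mathcal{J}$ (both always exist). -}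

module Defs where

open import Data.Product using (Σ; _×_; _,_)
open import Data.Sum using (_⊎_)
open import Relation.Nullary using (¬_)

Pow : Set → Set₁
Pow S = S → Set

_⊆_ : {S : Set} → Pow S → Pow S → Set
U ⊆ V = ∀ a → U a → V a

_≐_ : {S : Set} → Pow S → Pow S → Set
U ≐ V = (U ⊆ V) × (V ⊆ U)

_≬_ : {S : Set} → Pow S → Pow S → Set
_≬_ {S} U V = Σ S (λ a → U a × V a)

Op : Set → Set₁
Op S = Pow S → Pow S

_≤ₒ_ : {S : Set} → Op S → Op S → Set₁
O ≤ₒ O' = ∀ U → O U ⊆ O' U

_≡ₒ_ : {S : Set} → Op S → Op S → Set₁
O ≡ₒ O' = ∀ U → O U ≐ O' U

Monotone : {S : Set} → Op S → Set₁
Monotone O = ∀ U V → U ⊆ V → O U ⊆ O V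

Idempotent : {S : Set} → Op S → Set₁
Idempotent O = ∀ U → O (O U) ≐ O U

IsSaturation : {S : Set} → Op S → Set₁
IsSaturation A = Monotone A × Idempotent A × (∀ U → U ⊆ A U)

IsReduction : {S : Set} → Op S → Set₁
IsReduction J = Monotone J × Idempotent J × (∀ U → J U ⊆ U)

_◁_ : {S : Set} → Op S → Op S → Set₁
O ◁ O' = ∀ U V → O U ≬ O' V → U ≬ O' V

Is𝔸 : {S : Set} → Op S → Op S → Set₁
Is𝔸 J A = IsSaturation A × (A ◁ J)
          × (∀ B → IsSaturation B → B ◁ J → B ≤ₒ A)

Is𝕁 : {S : Set} → Op S → Op S → Set₁
Is𝕁 A J = IsReduction J × (A ◁ J)
          × (∀ K → IsReduction K → A ◁ K → K ≤ₒ J)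

LEM : Set₁
LEM = ∀ (P : Set) → P ⊎ ¬ P

-- Condition (i): for every set S and saturation A on S, 𝔸(𝕁(A)) = A.
-- 𝔸 and 𝕁 are characterised by their universal property.
ConditionI : Set₁
ConditionI = ∀ (S : Set) (A : Op S) → IsSaturation A →
             ∀ (J : Op S) → Is𝕁 A J →
             ∀ (A' : Op S) → Is𝔸 J A' → A' ≡ₒ A

-- Classically, J(V) = ¬A(¬V) is the greatest reduction with A ◁ J, and A(U) is
-- recovered from it: if x ∉ A(U), then x ∈ J(¬A(U)) while U misses ¬A(U), so
-- no saturation A' ◁ J can put x into A'(U).  Conversely, for a proposition Q
-- the saturation U ↦ U ∪ Q has 𝕁 = (V ↦ V ∩ ¬Q) and then 𝔸 = (U ↦ ¬Q → U);
-- comparing both saturations at U = ∅ is double negation elimination for Q.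
module Submission where

open import Defs
open import Axiom.DoubleNegationElimination using (DoubleNegationElimination)
open import Data.Empty using (⊥; ⊥-elim)
open import Data.Product using (_×_; _,_; proj₁; proj₂)
open import Data.Sum using (_⊎_; inj₁; inj₂; [_,_])
open import Data.Unit using (⊤; tt)
open import Function.Base using (id)
open import Function.Bundles using (_⇔_; mk⇔)
open import Level using (0ℓ)
open import Relation.Nullary using (¬_)
open import Relation.Nullary.Decidable using (decidable-stable; fromSum; toSum; ¬¬-excluded-middle)
open import Relation.Binary.PropositionalEquality using (_≡_; refl)
open import Relation.Unary using (∁)

DNE : Set₁
DNE = DoubleNegationElimination 0ℓ

lem⇒dne : LEM → DNE
lem⇒dne lem {P} = decidable-stable (fromSum (lem P))

dne⇒lem : DNE → LEM
dne⇒lem dne P = toSum (dne ¬¬-excluded-middle)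

module Saturation {S : Set} {A : Op S} (satA : IsSaturation A) where

  A-mono : ∀ {U V} → U ⊆ V → A U ⊆ A V
  A-mono = proj₁ satA _ _

  A-inflationary : ∀ U → U ⊆ A U
  A-inflationary = proj₂ (proj₂ satA)

  A-closed : ∀ {U V} → U ⊆ A V → A U ⊆ A V
  A-closed {U} {V} U⊆AV x a = proj₁ (proj₁ (proj₂ satA) V) x (A-mono U⊆AV x a)

module _ {S : Set} {A J A' : Op S} (satA : IsSaturation A)
         (isJ : Is𝕁 A J) (isA' : Is𝔸 J A') where

  ≤-𝔸𝕁 : A ≤ₒ A'
  ≤-𝔸𝕁 = proj₂ (proj₂ isA') A satA (proj₁ (proj₂ isJ))

  𝔸𝕁-excludes : ∀ U x → A' U x → J (∁ (A U)) x → ⊥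
  𝔸𝕁-excludes U x a' j with proj₁ (proj₂ isA') U (∁ (A U)) (x , a' , j)
  ... | y , u , jy = proj₂ (proj₂ (proj₁ isJ)) (∁ (A U)) y jy (A-inflationary U y u)
    where open Saturation satA

module Classical (dne : DNE) {S : Set} {A : Op S} (satA : IsSaturation A) where
  open Saturation satA

  dual : Op S
  dual V = ∁ (A (∁ V))

  A∁∁A⊆A : ∀ W → A (∁ (∁ (A W))) ⊆ A W
  A∁∁A⊆A W = A-closed (λ x → dne)

  ∁A⊆dual∁A : ∀ W → ∁ (A W) ⊆ dual (∁ (A W))
  ∁A⊆dual∁A W x ¬a a = ¬a (A∁∁A⊆A W x a)

  dual-isReduction : IsReduction dual
  dual-isReduction = mono , (λ V → deflationary (dual V) , ∁A⊆dual∁A (∁ V)) , deflationary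
    where
      mono : Monotone dual
      mono U V U⊆V x ¬a a = ¬a (A-mono (λ y ¬v u → ¬v (U⊆V y u)) x a)

      deflationary : ∀ V → dual V ⊆ V
      deflationary V x ¬a = dne (λ ¬v → ¬a (A-inflationary (∁ V) x ¬v))

  A◁dual : A ◁ dual
  A◁dual U V (x , a , ¬a∁V) = dne λ ¬meet →
    ¬a∁V (A-closed (λ y u → dne (λ ¬a → ¬meet (y , u , ¬a))) x a)

  𝔸𝕁⊆ : ∀ {J A'} → Is𝕁 A J → Is𝔸 J A' → A' ≤ₒ A
  𝔸𝕁⊆ isJ isA' U x a' = dne λ ¬a →
    𝔸𝕁-excludes satA isJ isA' U x a'
      (proj₂ (proj₂ isJ) dual dual-isReduction A◁dual (∁ (A U)) x (∁A⊆dual∁A U x ¬a))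

module Adjoin (Q : Set) {S : Set} where

  ∪Q : Op S
  ∪Q U x = U x ⊎ Q

  ∩¬Q : Op S
  ∩¬Q V x = V x × ¬ Q

  ¬Q⇒ : Op S
  ¬Q⇒ U x = ¬ Q → U x

  ∪Q-isSaturation : IsSaturation ∪Q
  ∪Q-isSaturation =
      (λ U V U⊆V x → [ (λ u → inj₁ (U⊆V x u)) , inj₂ ])
    , (λ U → (λ x → [ id , inj₂ ]) , (λ x → inj₁))
    , (λ U x → inj₁)

  ∩¬Q-is𝕁 : Is𝕁 ∪Q ∩¬Q
  ∩¬Q-is𝕁 =
      ( (λ U V U⊆V x (v , ¬q) → U⊆V x v , ¬q)
      , (λ V → (λ x → proj₁) , (λ x j → j , proj₂ j))
      , (λ V x → proj₁))
    , (λ { U V (x , inj₁ u , j) → x , u , j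
         ; U V (x , inj₂ q , (_ , ¬q)) → ⊥-elim (¬q q) })
    , λ K redK ∪Q◁K V x k →
        proj₂ (proj₂ redK) V x k
      , λ q → proj₁ (proj₂ (∪Q◁K (λ _ → ⊥) V (x , inj₂ q , k)))

  ¬Q⇒-is𝔸 : Is𝔸 ∩¬Q ¬Q⇒
  ¬Q⇒-is𝔸 =
      ( (λ U V U⊆V x f ¬q → U⊆V x (f ¬q))
      , (λ U → (λ x f ¬q → f ¬q ¬q) , (λ x f ¬q _ → f ¬q))
      , (λ U x u _ → u))
    , (λ { U V (x , f , (v , ¬q)) → x , f ¬q , (v , ¬q) })
    -- Testing B ◁ ∩¬Q against the singleton {x} pins the witness down to x.
    , λ B satB B◁∩¬Q U x b ¬q → at-x (B◁∩¬Q U (_≡ x) (x , b , refl , ¬q))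
    where
      at-x : ∀ {U : Pow S} {x} → U ≬ ∩¬Q (_≡ x) → U x
      at-x (_ , u , refl , _) = u

conditionI⇒dne : ConditionI → DNE
conditionI⇒dne ci {Q} ¬¬q =
  [ (λ ()) , id ] (proj₁ (ci ⊤ ∪Q ∪Q-isSaturation ∩¬Q ∩¬Q-is𝕁 ¬Q⇒ ¬Q⇒-is𝔸 (λ _ → ⊥)) tt ¬¬q)
  where open Adjoin Q

proposition4p3 : ConditionI ⇔ LEM
proposition4p3 = mk⇔
  (λ ci → dne⇒lem (conditionI⇒dne ci))
  (λ lem S A satA J isJ A' isA' U →
     Classical.𝔸𝕁⊆ (lem⇒dne lem) satA isJ isA' U , ≤-𝔸𝕁 satA isJ isA' U)
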